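{- For every integer $n\ge 2$, $$v(n\text{ - }pl)=K\cdot v(1\text{ - }pl),\qquad\text{where }K=\sum_{j=1}^{n-1}(2j^2+j+1)\,h_{n-1,j}$$ is an integer; in particular $v(1\text{ - }pl)=1$.
   Context: For positive integers $n,m$ with $m\le n$, the Goodman–Savage number is $h_{n,m}=\sum_{r=0}^{m}(-1)^r\frac{(m-r)^n}{(m-r)!\,r!}$ (convention $0^0=1$). The Goodman–Fine number (Goodman's maximum primary complexity value of an $n$-place predicate) is defined for each positive integer $n$ by $$v(n\text{ - }pl)=\sum_{k=1}^{n}\sum_{r=0}^{k}(-1)^r\,(2k-1)\,\frac{(k-r)^n}{(k-r)!\,r!}.$$ -}

module Defs where

open import Data.Nat as ℕ using (ℕ; zero; suc; _∸_; _^_; _!)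
open import Data.Nat.Properties using (_!*_!≢0)
open import Data.Integer as ℤ using (ℤ; +_)
open import Data.Rational as ℚ using (ℚ; 0ℚ; _+_; _*_; _/_; -_)

-- Σ[a..b] f = f a + ... + f b over ℚ (empty sum = 0 when b < a)
sumFromTo : ℕ → ℕ → (ℕ → ℚ) → ℚ
sumFromTo a b f = go (suc b ∸ a)
  where
  go : ℕ → ℚ
  go zero    = 0ℚ
  go (suc k) = go k + f (a ℕ.+ k)

sign : ℕ → ℚ
sign zero    = ℚ.1ℚ
sign (suc r) = - sign r

-- the rational (m-r)^n / ((m-r)! r!)   (Data.Nat has 0 ^ 0 = 1)
term : ℕ → ℕ → ℕ → ℚ
term n m r = ((+ ((m ∸ r) ^ n)) / ((m ∸ r) ! ℕ.* r !)) {{(m ∸ r) !* r !≢0}}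

h : ℕ → ℕ → ℚ
h n m = sumFromTo 0 m (λ r → sign r * term n m r)

v : ℕ → ℚ
v n = sumFromTo 1 n (λ k → sumFromTo 0 k (λ r →
        sign r * (((+ (2 ℕ.* k ∸ 1)) / 1) * term n k r)))

K : ℕ → ℚ
K n = sumFromTo 1 (n ∸ 1) (λ j →
        ((+ (2 ℕ.* j ℕ.* j ℕ.+ j ℕ.+ 1)) / 1) * h (n ∸ 1) j)

-- h n m is the Stirling number S(n,m) of the second kind: weighting its summands by
-- m = (m - r) + r, the (m - r)-part raises the exponent and the r-part is, after
-- r ↦ r + 1, minus the sum for h n (m - 1); this gives both the recurrence
-- S(n+1,m+1) = (m+1) S(n,m+1) + S(n,m) and h 0 (m+1) = 0.  Hence
-- v n = Σ (2k-1) S(n,k).  Expanding S(n,k) = k S(n-1,k) + S(n-1,k-1) and shifting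
-- the second sum turns the weight of S(n-1,j) into (2j-1) j + (2j+1) = 2j² + j + 1.
module Submission where

open import Defs
open import Data.Nat using (ℕ; _≤_)
open import Data.Integer using (ℤ)
open import Data.Rational using (ℚ; _*_; 1ℚ; _/_)
open import Data.Product using (_×_; ∃)
open import Relation.Binary.PropositionalEquality using (_≡_)

open import Algebra.Bundles using (CommutativeMonoid)
import Algebra.Properties.CommutativeSemigroup as CommSemigroupProperties
open import Data.Nat as ℕ using (zero; suc; NonZero; _∸_; _^_; _!; _<_; s≤s)
import Data.Nat.Properties as ℕP
open import Data.Nat.Tactic.RingSolver using (solve-∀)
open import Data.Integer as ℤ using (+_)
import Data.Integer.Properties as ℤP
open import Data.Rational as ℚ using (_+_; _-_; -_; 0ℚ; 1/_; fromℚᵘ)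
open import Data.Rational.Properties
import Data.Rational.Unnormalised as ℚᵘ
import Data.Rational.Unnormalised.Properties as ℚᵘP
open import Data.Product using (_,_)
open import Relation.Binary.PropositionalEquality using (refl; sym; trans; cong; cong₂; module ≡-Reasoning)

private
  module ℚ* = CommSemigroupProperties (CommutativeMonoid.commutativeSemigroup *-1-commutativeMonoid)
  module ℚ+ = CommSemigroupProperties (CommutativeMonoid.commutativeSemigroup +-0-commutativeMonoid)
  module ℕ* = CommSemigroupProperties ℕP.*-commutativeSemigroup
  module ℕ+ = CommSemigroupProperties ℕP.+-commutativeSemigroup

fromℚᵘ-homo-+ : ∀ p q → fromℚᵘ (p ℚᵘ.+ q) ≡ fromℚᵘ p + fromℚᵘ q
fromℚᵘ-homo-+ p q = toℚᵘ-injective (ℚᵘP.≃-trans (toℚᵘ-fromℚᵘ (p ℚᵘ.+ q)) (ℚᵘP.≃-sym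
  (ℚᵘP.≃-trans (toℚᵘ-homo-+ (fromℚᵘ p) (fromℚᵘ q)) (ℚᵘP.+-cong (toℚᵘ-fromℚᵘ p) (toℚᵘ-fromℚᵘ q)))))

fromℚᵘ-homo-* : ∀ p q → fromℚᵘ (p ℚᵘ.* q) ≡ fromℚᵘ p * fromℚᵘ q
fromℚᵘ-homo-* p q = toℚᵘ-injective (ℚᵘP.≃-trans (toℚᵘ-fromℚᵘ (p ℚᵘ.* q)) (ℚᵘP.≃-sym
  (ℚᵘP.≃-trans (toℚᵘ-homo-* (fromℚᵘ p) (fromℚᵘ q)) (ℚᵘP.*-cong (toℚᵘ-fromℚᵘ p) (toℚᵘ-fromℚᵘ q)))))

/-+-/ : ∀ x y a b .{{_ : NonZero a}} .{{_ : NonZero b}} →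
        x / a + y / b ≡ ((x ℤ.* + b ℤ.+ y ℤ.* + a) / (a ℕ.* b)) {{ℕP.m*n≢0 a b}}
/-+-/ x y (suc a) (suc b) = sym (fromℚᵘ-homo-+ (ℚᵘ.mkℚᵘ x a) (ℚᵘ.mkℚᵘ y b))

/-*-/ : ∀ x y a b .{{_ : NonZero a}} .{{_ : NonZero b}} →
        (x / a) * (y / b) ≡ ((x ℤ.* y) / (a ℕ.* b)) {{ℕP.m*n≢0 a b}}
/-*-/ x y (suc a) (suc b) = sym (fromℚᵘ-homo-* (ℚᵘ.mkℚᵘ x a) (ℚᵘ.mkℚᵘ y b))

+/-≡ : ∀ x y a b .{{_ : NonZero a}} .{{_ : NonZero b}} →
       x ℕ.* b ≡ y ℕ.* a → + x / a ≡ + y / b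
+/-≡ x y (suc a) (suc b) xb≡ya = fromℚᵘ-cong {ℚᵘ.mkℚᵘ (+ x) a} {ℚᵘ.mkℚᵘ (+ y) b} (ℚᵘ.*≡* (begin
  + x ℤ.* + suc b   ≡⟨ ℤP.pos-* x (suc b) ⟨
  + (x ℕ.* suc b)   ≡⟨ cong +_ xb≡ya ⟩
  + (y ℕ.* suc a)   ≡⟨ ℤP.pos-* y (suc a) ⟩
  + y ℤ.* + suc a   ∎))
  where open ≡-Reasoning

fromℕ : ℕ → ℚ
fromℕ k = + k / 1

fromℕ-+ : ∀ a b → fromℕ (a ℕ.+ b) ≡ fromℕ a + fromℕ b
fromℕ-+ a b = sym (trans (/-+-/ (+ a) (+ b) 1 1)
  (cong (_/ 1) (trans (cong₂ ℤ._+_ (ℤP.*-identityʳ (+ a)) (ℤP.*-identityʳ (+ b))) (sym (ℤP.pos-+ a b)))))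

fromℕ-* : ∀ a b → fromℕ (a ℕ.* b) ≡ fromℕ a * fromℕ b
fromℕ-* a b = sym (trans (/-*-/ (+ a) (+ b) 1 1) (cong (_/ 1) (sym (ℤP.pos-* a b))))

fromℕ-∸ : ∀ {m r} → r ≤ m → fromℕ m ≡ fromℕ (m ∸ r) + fromℕ r
fromℕ-∸ {m} {r} r≤m = trans (cong fromℕ (sym (ℕP.m∸n+n≡m r≤m))) (fromℕ-+ (m ∸ r) r)

fromℕ-*-/ : ∀ c x D .{{_ : NonZero D}} → fromℕ c * (+ x / D) ≡ + (c ℕ.* x) / D
fromℕ-*-/ c x D = begin
  fromℕ c * (+ x / D)         ≡⟨ /-*-/ (+ c) (+ x) 1 D ⟩
  (+ c ℤ.* + x) / (1 ℕ.* D)   ≡⟨ cong (_/ (1 ℕ.* D)) (ℤP.pos-* c x) ⟨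
  + (c ℕ.* x) / (1 ℕ.* D)     ≡⟨ +/-≡ (c ℕ.* x) (c ℕ.* x) (1 ℕ.* D) D
                                   (cong ((c ℕ.* x) ℕ.*_) (sym (ℕP.*-identityˡ D))) ⟩
  + (c ℕ.* x) / D             ∎
  where
  open ≡-Reasoning
  instance
    1*D≢0 : NonZero (1 ℕ.* D)
    1*D≢0 = ℕP.m*n≢0 1 D

*-cancelˡ-0 : ∀ c x .{{_ : ℚ.NonZero c}} → c * x ≡ 0ℚ → x ≡ 0ℚ
*-cancelˡ-0 c x cx≡0 = begin
  x                ≡⟨ *-identityˡ x ⟨
  1ℚ * x           ≡⟨ cong (_* x) (*-inverseˡ c) ⟨
  (1/ c) * c * x   ≡⟨ *-assoc (1/ c) c x ⟩
  (1/ c) * (c * x) ≡⟨ cong ((1/ c) *_) cx≡0 ⟩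
  (1/ c) * 0ℚ      ≡⟨ *-zeroʳ (1/ c) ⟩
  0ℚ               ∎
  where open ≡-Reasoning

fromℕ-suc-nonZero : ∀ m → ℚ.NonZero (fromℕ (suc m))
fromℕ-suc-nonZero m = pos⇒nonZero (fromℕ (suc m)) {{normalize-pos (suc m) 1}}

Σ₀ : ℕ → (ℕ → ℚ) → ℚ
Σ₀ = sumFromTo 0

Σ₀-cong : ∀ m {f g} → (∀ i → i ≤ m → f i ≡ g i) → Σ₀ m f ≡ Σ₀ m g
Σ₀-cong zero    f≗g = cong (_+_ 0ℚ) (f≗g 0 ℕ.z≤n)
Σ₀-cong (suc m) f≗g = cong₂ _+_ (Σ₀-cong m (λ i i≤m → f≗g i (ℕP.m≤n⇒m≤1+n i≤m))) (f≗g (suc m) ℕP.≤-refl)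

Σ₀-+ : ∀ m f g → Σ₀ m (λ i → f i + g i) ≡ Σ₀ m f + Σ₀ m g
Σ₀-+ zero    f g = ℚ+.interchange 0ℚ 0ℚ (f 0) (g 0)
Σ₀-+ (suc m) f g = trans (cong (_+ (f (suc m) + g (suc m))) (Σ₀-+ m f g))
  (ℚ+.interchange (Σ₀ m f) (Σ₀ m g) (f (suc m)) (g (suc m)))

Σ₀-*ˡ : ∀ m c f → Σ₀ m (λ i → c * f i) ≡ c * Σ₀ m f
Σ₀-*ˡ zero    c f = sym (trans (*-distribˡ-+ c 0ℚ (f 0)) (cong (_+ c * f 0) (*-zeroʳ c)))
Σ₀-*ˡ (suc m) c f = trans (cong (_+ c * f (suc m)) (Σ₀-*ˡ m c f)) (sym (*-distribˡ-+ c (Σ₀ m f) (f (suc m))))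

Σ₀-neg : ∀ m f → Σ₀ m (λ i → - f i) ≡ - Σ₀ m f
Σ₀-neg zero    f = sym (neg-distrib-+ 0ℚ (f 0))
Σ₀-neg (suc m) f = trans (cong (_+ - f (suc m)) (Σ₀-neg m f)) (sym (neg-distrib-+ (Σ₀ m f) (f (suc m))))

Σ₀-suc : ∀ m f → Σ₀ (suc m) f ≡ f 0 + Σ₀ m (λ i → f (suc i))
Σ₀-suc zero    f = trans (cong (_+ f 1) (+-identityˡ (f 0))) (cong (_+_ (f 0)) (sym (+-identityˡ (f 1))))
Σ₀-suc (suc m) f = trans (cong (_+ f (suc (suc m))) (Σ₀-suc m f))
  (+-assoc (f 0) (Σ₀ m (λ i → f (suc i))) (f (suc (suc m))))

Σ₁ℕ : ℕ → (ℕ → ℕ) → ℕ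
Σ₁ℕ zero    f = 0
Σ₁ℕ (suc m) f = Σ₁ℕ m f ℕ.+ f (suc m)

sumFromTo-1-fromℕ : ∀ m {g} f → (∀ j → g j ≡ fromℕ (f j)) → sumFromTo 1 m g ≡ fromℕ (Σ₁ℕ m f)
sumFromTo-1-fromℕ zero    f g≗f = refl
sumFromTo-1-fromℕ (suc m) f g≗f = trans (cong₂ _+_ (sumFromTo-1-fromℕ m f g≗f) (g≗f (suc m)))
  (sym (fromℕ-+ (Σ₁ℕ m f) (f (suc m))))

-- The Goodman–Savage numbers are Stirling numbers of the second kind

hTerm : ℕ → ℕ → ℕ → ℚ
hTerm n m r = sign r * term n m r

*-hTerm : ∀ c n m r → c * hTerm n m r ≡ sign r * (c * term n m r)
*-hTerm c n m r = ℚ*.x∙yz≈y∙xz c (sign r) (term n m r)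

fromℕ-*-/-cancel : ∀ c x D d .{{_ : NonZero D}} .{{_ : NonZero d}} → D ≡ c ℕ.* d →
                   fromℕ c * (+ x / D) ≡ + x / d
fromℕ-*-/-cancel c x D d D≡cd = trans (fromℕ-*-/ c x D) (+/-≡ (c ℕ.* x) x D d (begin
  c ℕ.* x ℕ.* d   ≡⟨ ℕ*.xy∙z≈y∙xz c x d ⟩
  x ℕ.* (c ℕ.* d) ≡⟨ cong (x ℕ.*_) D≡cd ⟨
  x ℕ.* D         ∎))
  where open ≡-Reasoning

hTerm-suc : ∀ n m r → hTerm (suc n) m r ≡ fromℕ (m ∸ r) * hTerm n m r
hTerm-suc n m r = sym (trans (*-hTerm (fromℕ (m ∸ r)) n m r) (cong (sign r *_)
  (fromℕ-*-/ (m ∸ r) ((m ∸ r) ^ n) ((m ∸ r) ! ℕ.* r !) {{(m ∸ r) ℕP.!* r !≢0}})))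

suc*hTerm-suc : ∀ n m r → fromℕ (suc r) * hTerm n (suc m) (suc r) ≡ - hTerm n m r
suc*hTerm-suc n m r = begin
  fromℕ (suc r) * hTerm n (suc m) (suc r)     ≡⟨ *-hTerm (fromℕ (suc r)) n (suc m) (suc r) ⟩
  - sign r * (fromℕ (suc r) * term n (suc m) (suc r))
    ≡⟨ cong (λ t → - sign r * t) (fromℕ-*-/-cancel (suc r) ((m ∸ r) ^ n)
         ((m ∸ r) ! ℕ.* (suc r) !) ((m ∸ r) ! ℕ.* r !)
         {{(m ∸ r) ℕP.!* (suc r) !≢0}} {{(m ∸ r) ℕP.!* r !≢0}}
         (ℕ*.x∙yz≈y∙xz ((m ∸ r) !) (suc r) (r !))) ⟩
  - sign r * term n m r                       ≡⟨ neg-distribˡ-* (sign r) (term n m r) ⟨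
  - hTerm n m r                               ∎
  where open ≡-Reasoning

Σ₀-index*hTerm : ∀ n m → Σ₀ (suc m) (λ r → fromℕ r * hTerm n (suc m) r) ≡ - h n m
Σ₀-index*hTerm n m = begin
  Σ₀ (suc m) (λ r → fromℕ r * hTerm n (suc m) r)
    ≡⟨ Σ₀-suc m (λ r → fromℕ r * hTerm n (suc m) r) ⟩
  0ℚ * hTerm n (suc m) 0 + Σ₀ m (λ r → fromℕ (suc r) * hTerm n (suc m) (suc r))
    ≡⟨ cong₂ _+_ (*-zeroˡ (hTerm n (suc m) 0)) (Σ₀-cong m (λ r _ → suc*hTerm-suc n m r)) ⟩
  0ℚ + Σ₀ m (λ r → - hTerm n m r)
    ≡⟨ +-identityˡ _ ⟩
  Σ₀ m (λ r → - hTerm n m r)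
    ≡⟨ Σ₀-neg m (hTerm n m) ⟩
  - h n m ∎
  where open ≡-Reasoning

suc*h : ∀ n m → fromℕ (suc m) * h n (suc m) ≡ Σ₀ (suc m) (λ r → fromℕ (suc m ∸ r) * hTerm n (suc m) r) - h n m
suc*h n m = begin
  fromℕ M * h n M                                          ≡⟨ Σ₀-*ˡ M (fromℕ M) (hTerm n M) ⟨
  Σ₀ M (λ r → fromℕ M * hTerm n M r)                       ≡⟨ Σ₀-cong M split ⟩
  Σ₀ M (λ r → fromℕ (M ∸ r) * hTerm n M r + fromℕ r * hTerm n M r)
    ≡⟨ Σ₀-+ M (λ r → fromℕ (M ∸ r) * hTerm n M r) (λ r → fromℕ r * hTerm n M r) ⟩
  Σ₀ M (λ r → fromℕ (M ∸ r) * hTerm n M r) + Σ₀ M (λ r → fromℕ r * hTerm n M r)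
    ≡⟨ cong (_+_ (Σ₀ M (λ r → fromℕ (M ∸ r) * hTerm n M r))) (Σ₀-index*hTerm n m) ⟩
  Σ₀ M (λ r → fromℕ (M ∸ r) * hTerm n M r) - h n m         ∎
  where
  open ≡-Reasoning
  M = suc m
  split : ∀ r → r ≤ M → fromℕ M * hTerm n M r ≡ fromℕ (M ∸ r) * hTerm n M r + fromℕ r * hTerm n M r
  split r r≤M = trans (cong (_* hTerm n M r) (fromℕ-∸ r≤M)) (*-distribʳ-+ (hTerm n M r) (fromℕ (M ∸ r)) (fromℕ r))

p-q+q≡p : ∀ p q → p - q + q ≡ p
p-q+q≡p p q = trans (+-assoc p (- q) q) (trans (cong (_+_ p) (+-inverseˡ q)) (+-identityʳ p))

h-suc-suc : ∀ n m → h (suc n) (suc m) ≡ fromℕ (suc m) * h n (suc m) + h n m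
h-suc-suc n m = begin
  h (suc n) (suc m)                                         ≡⟨ Σ₀-cong (suc m) (λ r _ → hTerm-suc n (suc m) r) ⟩
  Σ₀ (suc m) (λ r → fromℕ (suc m ∸ r) * hTerm n (suc m) r)  ≡⟨ p-q+q≡p _ (h n m) ⟨
  Σ₀ (suc m) (λ r → fromℕ (suc m ∸ r) * hTerm n (suc m) r) - h n m + h n m
                                                            ≡⟨ cong (_+ h n m) (suc*h n m) ⟨
  fromℕ (suc m) * h n (suc m) + h n m                       ∎
  where open ≡-Reasoning

h-zero-suc : ∀ m → h 0 (suc m) ≡ 0ℚ
h-zero-suc m = *-cancelˡ-0 (fromℕ (suc m)) (h 0 (suc m)) {{fromℕ-suc-nonZero m}} (begin
  fromℕ (suc m) * h 0 (suc m)                                 ≡⟨ suc*h 0 m ⟩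
  Σ₀ m (λ r → fromℕ (suc m ∸ r) * hTerm 0 (suc m) r)
    + fromℕ (m ∸ m) * hTerm 0 (suc m) (suc m) - h 0 m         ≡⟨ cong (λ s → s - h 0 m) (cong₂ _+_
                                                                   (Σ₀-cong m hTerm-zero-suc)
                                                                   last-term-zero) ⟩
  h 0 m + 0ℚ - h 0 m                                          ≡⟨ cong (_- h 0 m) (+-identityʳ (h 0 m)) ⟩
  h 0 m - h 0 m                                               ≡⟨ +-inverseʳ (h 0 m) ⟩
  0ℚ                                                          ∎)
  where
  open ≡-Reasoning
  last-term-zero : fromℕ (m ∸ m) * hTerm 0 (suc m) (suc m) ≡ 0ℚ
  last-term-zero = trans (cong (λ k → fromℕ k * hTerm 0 (suc m) (suc m)) (ℕP.n∸n≡0 m)) (*-zeroˡ (hTerm 0 (suc m) (suc m)))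
  !-unfold : ∀ {c k} B → c ≡ suc k → c ! ℕ.* B ≡ c ℕ.* (k ! ℕ.* B)
  !-unfold {k = k} B refl = ℕP.*-assoc (suc k) (k !) B
  hTerm-zero-suc : ∀ r → r ≤ m → fromℕ (suc m ∸ r) * hTerm 0 (suc m) r ≡ hTerm 0 m r
  hTerm-zero-suc r r≤m = trans (*-hTerm (fromℕ (suc m ∸ r)) 0 (suc m) r) (cong (sign r *_)
    (fromℕ-*-/-cancel (suc m ∸ r) 1 ((suc m ∸ r) ! ℕ.* r !) ((m ∸ r) ! ℕ.* r !)
      {{(suc m ∸ r) ℕP.!* r !≢0}} {{(m ∸ r) ℕP.!* r !≢0}}
      (!-unfold (r !) (ℕP.+-∸-assoc 1 r≤m))))

S₂ : ℕ → ℕ → ℕ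
S₂ zero    zero    = 1
S₂ zero    (suc m) = 0
S₂ (suc n) zero    = 0
S₂ (suc n) (suc m) = suc m ℕ.* S₂ n (suc m) ℕ.+ S₂ n m

h≡S₂ : ∀ n m → h n m ≡ fromℕ (S₂ n m)
h≡S₂ zero    zero    = refl
h≡S₂ zero    (suc m) = h-zero-suc m
h≡S₂ (suc n) zero    = refl
h≡S₂ (suc n) (suc m) = begin
  h (suc n) (suc m)                                          ≡⟨ h-suc-suc n m ⟩
  fromℕ (suc m) * h n (suc m) + h n m                        ≡⟨ cong₂ (λ a b → fromℕ (suc m) * a + b) (h≡S₂ n (suc m)) (h≡S₂ n m) ⟩
  fromℕ (suc m) * fromℕ (S₂ n (suc m)) + fromℕ (S₂ n m)      ≡⟨ cong (_+ fromℕ (S₂ n m)) (fromℕ-* (suc m) (S₂ n (suc m))) ⟨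
  fromℕ (suc m ℕ.* S₂ n (suc m)) + fromℕ (S₂ n m)            ≡⟨ fromℕ-+ (suc m ℕ.* S₂ n (suc m)) (S₂ n m) ⟨
  fromℕ (S₂ (suc n) (suc m))                                 ∎
  where open ≡-Reasoning

-- The Stirling-number identity

n<m⇒S₂[n,m]≡0 : ∀ {n m} → n < m → S₂ n m ≡ 0
n<m⇒S₂[n,m]≡0 {zero}  {suc m} _          = refl
n<m⇒S₂[n,m]≡0 {suc n} {suc m} (s≤s n<m) = begin
  suc m ℕ.* S₂ n (suc m) ℕ.+ S₂ n m ≡⟨ cong₂ (λ a b → suc m ℕ.* a ℕ.+ b)
                                         (n<m⇒S₂[n,m]≡0 (ℕP.m<n⇒m<1+n n<m)) (n<m⇒S₂[n,m]≡0 n<m) ⟩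
  suc m ℕ.* 0 ℕ.+ 0                 ≡⟨ ℕP.+-identityʳ (suc m ℕ.* 0) ⟩
  suc m ℕ.* 0                       ≡⟨ ℕP.*-zeroʳ (suc m) ⟩
  0                                 ∎
  where open ≡-Reasoning

Σ₁ℕ-cong : ∀ m {f g} → (∀ i → f i ≡ g i) → Σ₁ℕ m f ≡ Σ₁ℕ m g
Σ₁ℕ-cong zero    f≗g = refl
Σ₁ℕ-cong (suc m) f≗g = cong₂ ℕ._+_ (Σ₁ℕ-cong m f≗g) (f≗g (suc m))

Σ₁ℕ-+ : ∀ m f g → Σ₁ℕ m (λ i → f i ℕ.+ g i) ≡ Σ₁ℕ m f ℕ.+ Σ₁ℕ m g
Σ₁ℕ-+ zero    f g = refl
Σ₁ℕ-+ (suc m) f g = trans (cong (ℕ._+ (f (suc m) ℕ.+ g (suc m))) (Σ₁ℕ-+ m f g))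
  (ℕ+.interchange (Σ₁ℕ m f) (Σ₁ℕ m g) (f (suc m)) (g (suc m)))

Σ₁ℕ-suc : ∀ m f → Σ₁ℕ (suc m) f ≡ f 1 ℕ.+ Σ₁ℕ m (λ i → f (suc i))
Σ₁ℕ-suc zero    f = ℕP.+-comm 0 (f 1)
Σ₁ℕ-suc (suc m) f = trans (cong (ℕ._+ f (suc (suc m))) (Σ₁ℕ-suc m f))
  (ℕP.+-assoc (f 1) (Σ₁ℕ m (λ i → f (suc i))) (f (suc (suc m))))

2[1+n]∸1≡1+2n : ∀ n → 2 ℕ.* suc n ∸ 1 ≡ suc (2 ℕ.* n)
2[1+n]∸1≡1+2n n = ℕP.+-suc n (n ℕ.+ 0)

[2j-1]j+[2j+1]≡2j²+j+1 : ∀ j s → (2 ℕ.* j ∸ 1) ℕ.* (j ℕ.* s) ℕ.+ (2 ℕ.* suc j ∸ 1) ℕ.* s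
                                  ≡ (2 ℕ.* j ℕ.* j ℕ.+ j ℕ.+ 1) ℕ.* s
[2j-1]j+[2j+1]≡2j²+j+1 zero    s = refl
[2j-1]j+[2j+1]≡2j²+j+1 (suc i) s =
  trans (cong₂ (λ a b → a ℕ.* (suc i ℕ.* s) ℕ.+ b ℕ.* s) (2[1+n]∸1≡1+2n i) (2[1+n]∸1≡1+2n (suc i)))
        (polynomial i s)
  where
  polynomial : ∀ i s → suc (2 ℕ.* i) ℕ.* (suc i ℕ.* s) ℕ.+ suc (2 ℕ.* suc i) ℕ.* s
                       ≡ (2 ℕ.* suc i ℕ.* suc i ℕ.+ suc i ℕ.+ 1) ℕ.* s
  polynomial = solve-∀

Σ[2k-1]S₂[1+p,k]≡Σ[2j²+j+1]S₂[p,j] : ∀ p .{{_ : NonZero p}} →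
  Σ₁ℕ (suc p) (λ k → (2 ℕ.* k ∸ 1) ℕ.* S₂ (suc p) k) ≡ Σ₁ℕ p (λ j → (2 ℕ.* j ℕ.* j ℕ.+ j ℕ.+ 1) ℕ.* S₂ p j)
Σ[2k-1]S₂[1+p,k]≡Σ[2j²+j+1]S₂[p,j] p@(suc _) = begin
  Σ₁ℕ (suc p) (λ k → w k ℕ.* S₂ (suc p) k)        ≡⟨ Σ₁ℕ-cong (suc p) expand ⟩
  Σ₁ℕ (suc p) (λ k → F k ℕ.+ G k)                 ≡⟨ Σ₁ℕ-+ (suc p) F G ⟩
  Σ₁ℕ (suc p) F ℕ.+ Σ₁ℕ (suc p) G                 ≡⟨ cong₂ ℕ._+_ F-last-vanishes (Σ₁ℕ-suc p G) ⟩
  Σ₁ℕ p F ℕ.+ Σ₁ℕ p (λ j → G (suc j))             ≡⟨ Σ₁ℕ-+ p F (λ j → G (suc j)) ⟨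
  Σ₁ℕ p (λ j → F j ℕ.+ G (suc j))                 ≡⟨ Σ₁ℕ-cong p (λ j → [2j-1]j+[2j+1]≡2j²+j+1 j (S₂ p j)) ⟩
  Σ₁ℕ p (λ j → (2 ℕ.* j ℕ.* j ℕ.+ j ℕ.+ 1) ℕ.* S₂ p j) ∎
  where
  open ≡-Reasoning
  w F G : ℕ → ℕ
  w k = 2 ℕ.* k ∸ 1
  F k = w k ℕ.* (k ℕ.* S₂ p k)
  G k = w k ℕ.* S₂ p (ℕ.pred k)
  expand : ∀ k → w k ℕ.* S₂ (suc p) k ≡ F k ℕ.+ G k
  expand zero    = refl
  expand (suc k) = ℕP.*-distribˡ-+ (w (suc k)) (suc k ℕ.* S₂ p (suc k)) (S₂ p k)
  F-last-vanishes : Σ₁ℕ (suc p) F ≡ Σ₁ℕ p F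
  F-last-vanishes = begin
    Σ₁ℕ p F ℕ.+ w (suc p) ℕ.* (suc p ℕ.* S₂ p (suc p)) ≡⟨ cong (λ s → Σ₁ℕ p F ℕ.+ w (suc p) ℕ.* (suc p ℕ.* s))
                                                              (n<m⇒S₂[n,m]≡0 (ℕP.n<1+n p)) ⟩
    Σ₁ℕ p F ℕ.+ w (suc p) ℕ.* (suc p ℕ.* 0)           ≡⟨ cong (λ s → Σ₁ℕ p F ℕ.+ w (suc p) ℕ.* s) (ℕP.*-zeroʳ (suc p)) ⟩
    Σ₁ℕ p F ℕ.+ w (suc p) ℕ.* 0                       ≡⟨ cong (Σ₁ℕ p F ℕ.+_) (ℕP.*-zeroʳ (w (suc p))) ⟩
    Σ₁ℕ p F ℕ.+ 0                                     ≡⟨ ℕP.+-identityʳ (Σ₁ℕ p F) ⟩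
    Σ₁ℕ p F                                           ∎

v≡fromℕ : ∀ n → v n ≡ fromℕ (Σ₁ℕ n (λ k → (2 ℕ.* k ∸ 1) ℕ.* S₂ n k))
v≡fromℕ n = sumFromTo-1-fromℕ n (λ k → (2 ℕ.* k ∸ 1) ℕ.* S₂ n k) λ k →
  let w = fromℕ (2 ℕ.* k ∸ 1) in begin
    Σ₀ k (λ r → sign r * (w * term n k r)) ≡⟨ Σ₀-cong k (λ r _ → *-hTerm w n k r) ⟨
    Σ₀ k (λ r → w * hTerm n k r)           ≡⟨ Σ₀-*ˡ k w (hTerm n k) ⟩
    w * h n k                              ≡⟨ cong (w *_) (h≡S₂ n k) ⟩
    w * fromℕ (S₂ n k)                     ≡⟨ fromℕ-* (2 ℕ.* k ∸ 1) (S₂ n k) ⟨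
    fromℕ ((2 ℕ.* k ∸ 1) ℕ.* S₂ n k)       ∎
  where open ≡-Reasoning

K≡fromℕ : ∀ n → K n ≡ fromℕ (Σ₁ℕ (n ∸ 1) (λ j → (2 ℕ.* j ℕ.* j ℕ.+ j ℕ.+ 1) ℕ.* S₂ (n ∸ 1) j))
K≡fromℕ n = sumFromTo-1-fromℕ (n ∸ 1) _ λ j →
  trans (cong (fromℕ c[ j ] *_) (h≡S₂ (n ∸ 1) j)) (sym (fromℕ-* c[ j ] (S₂ (n ∸ 1) j)))
  where
  c[_] : ℕ → ℕ
  c[ j ] = 2 ℕ.* j ℕ.* j ℕ.+ j ℕ.+ 1

proposition4 : (n : ℕ) → 2 ≤ n →
    (v n ≡ K n * v 1) × (∃ λ (z : ℤ) → K n ≡ z / 1) × (v 1 ≡ 1ℚ)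
proposition4 (suc zero) (s≤s ())
proposition4 n@(suc p@(suc _)) _ =
  v≡K , (+ Σ₁ℕ p (λ j → (2 ℕ.* j ℕ.* j ℕ.+ j ℕ.+ 1) ℕ.* S₂ p j) , K≡fromℕ n) , refl
  where
  open ≡-Reasoning
  v≡K : v n ≡ K n * v 1
  v≡K = begin
    v n                                                        ≡⟨ v≡fromℕ n ⟩
    fromℕ (Σ₁ℕ n (λ k → (2 ℕ.* k ∸ 1) ℕ.* S₂ n k))             ≡⟨ cong fromℕ (Σ[2k-1]S₂[1+p,k]≡Σ[2j²+j+1]S₂[p,j] p) ⟩
    fromℕ (Σ₁ℕ p (λ j → (2 ℕ.* j ℕ.* j ℕ.+ j ℕ.+ 1) ℕ.* S₂ p j)) ≡⟨ K≡fromℕ n ⟨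
    K n                                                        ≡⟨ *-identityʳ (K n) ⟨
    K n * v 1                                                  ∎
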